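{- Every formula of $\mathcal{L}_{qu}$ defines a quasi upward closed team property, every formula of $\mathcal{L}_{u}$ defines an upward closed team property, every formula of $\mathcal{L}_{qd}$ defines a quasi downward closed team property, and every formula of $\mathcal{L}_{d}$ defines a downward closed team property. That is, for every formula $\phi$ of the respective logic, $\lVert\phi\rVert$ has the stated closure property.
   Context: Fix a finite set $\mathbb{P}$ of propositional symbols. A valuation is a map $v:\mathbb{P}\to\{0,1\}$, extended by $v(\top)=1$, $v(\bot)=0$. A team is a set of valuations; the full team is $\mathbb{F}=2^{\mathbb{P}}$ (the set of all valuations). For a sequence $\mathsf{a}=a_1\dots a_k$ of elements of $\mathbb{P}\cup\{\top,\bot\}$, $v(\mathsf{a})=(v(a_1),\dots,v(a_k))$. For a formula $\phi$, $\lVert\phi\rVert=\{T\subseteq\mathbb{F}: T\models\phi\}$. A collection $\mathcal{C}$ of teams is: downward closed if $T\in\mathcal{C}$, $S\subseteq T$ imply $S\in\mathcal{C}$; quasi downward closed if $\mathbb{F}\in\mathcal{C}$ and $\mathcal{C}\setminus\{\mathbb{F}\}$ is downward closed; upward closed if $T\in\mathcal{C}$, $S\supseteq T$ imply $S\in\mathcal{C}$; quasi upward closed if $\emptyset\in\mathcal{C}$ and $\mathcal{C}\setminus\{\emptyset\}$ is upward closed. Semantics: $T\models\top$ always; $T\models\bot$ iff $T=\emptyset$; $T\models\bullet$ iff $T=\mathbb{F}$; for sequences $\mathsf{a},\mathsf{b}$ of equal length, $T\models\mathsf{a}\subseteq\mathsf{b}$ iff for every $v\in T$ there is $v'\in T$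 with $v(\mathsf{a})=v'(\mathsf{b})$; $T\models\mathsf{a}\subseteqq\mathsf{b}$ (nonempty inclusion atom) iff $T\neq\emptyset$ and $T\models\mathsf{a}\subseteq\mathsf{b}$; $T\models\mathsf{a}\subseteq^{\bullet}\mathsf{b}$ (full inclusion atom) iff $T=\mathbb{F}$ or $T\models\mathsf{a}\subseteq\mathsf{b}$; $T\models\phi\land\psi$ iff $T\models\phi$ and $T\models\psi$; $T\models\phi\lor\psi$ iff there are $T_1,T_2\subseteq T$ with $T_1\cup T_2=T$, $T_1\models\phi$, $T_2\models\psi$; $T\models\phi\sqcup\psi$ (global disjunction) iff $T\models\phi$ or $T\models\psi$. Syntax: $\mathsf{x}$ ranges over finite sequences of the constants $\top,\bot$ and $\mathsf{p}$ over finite sequences of symbols from $\mathbb{P}$, with $|\mathsf{x}|=|\mathsf{p}|$; in the atoms $\mathsf{x}\subseteq\mathsf{p}$ of $\mathcal{L}_{qu}$ and $\mathsf{x}\subseteqq\mathsf{p}$ of $\mathcal{L}_u$, $\mathsf{p}$ contains no repeated symbol. The grammars are: $\mathcal{L}_{qu}$: $\phi::=\bot\mid\mathsf{x}\subseteq\mathsf{p}\mid\phi\land\phi\mid\phi\sqcup\phi$; $\mathcal{L}_u$: $\phi::=\top\mid\mathsf{x}\subseteqq\mathsf{p}\mid\phi\land\phi\mid\phi\sqcup\phi$; $\mathcal{L}_{qd}$: $\phi::=\bullet\mid\mathsf{p}\subseteq^{\bullet}\mathsf{x}\mid\phi\land\phi\mid\phi\lor\phi\mid\phi\sqcup\phi$;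 $\mathcal{L}_d$: $\phi::=\bot\mid\mathsf{p}\subseteq\mathsf{x}\mid\phi\land\phi\mid\phi\lor\phi\mid\phi\sqcup\phi$. -}

module Defs where

open import Data.Nat using (ℕ)
open import Data.Bool using (Bool; true; false)
open import Data.Fin using (Fin)
open import Data.Vec using (Vec; lookup; map)
open import Data.Product using (Σ; ∃; _×_)
open import Data.Sum using (_⊎_)
open import Data.Unit using (⊤)
open import Relation.Nullary using (¬_)
open import Relation.Binary.PropositionalEquality using (_≡_)
open import Function.Definitions using (Injective)

-- Propositional symbols: ℙ = Fin n.  A valuation is a Vec Bool n
-- (v(i) = lookup v i).  The full team 𝔽 is the set of all valuations.
Valuation : ℕ → Set
Valuation n = Vec Bool n

Team : ℕ → Set
Team n = Valuation n → Bool

module _ {n : ℕ} where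

  _∈T_ : Valuation n → Team n → Set
  v ∈T T = T v ≡ true

  _⊆T_ : Team n → Team n → Set
  S ⊆T T = ∀ v → v ∈T S → v ∈T T

  IsFull : Team n → Set
  IsFull T = ∀ v → v ∈T T

  IsEmpty : Team n → Set
  IsEmpty T = ∀ v → ¬ (v ∈T T)

  fullTeam : Team n
  fullTeam _ = true

  emptyTeam : Team n
  emptyTeam _ = false

  TeamProp : Set₁
  TeamProp = Team n → Set

  DownwardClosed : TeamProp → Set
  DownwardClosed C = ∀ T S → C T → S ⊆T T → C S

  UpwardClosed : TeamProp → Set
  UpwardClosed C = ∀ T S → C T → T ⊆T S → C S

  QuasiDownwardClosed : TeamProp → Set
  QuasiDownwardClosed C =
    C fullTeam × (∀ T S → C T → ¬ IsFull T → ¬ IsFull S → S ⊆T T → C S)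

  QuasiUpwardClosed : TeamProp → Set
  QuasiUpwardClosed C =
    C emptyTeam × (∀ T S → C T → ¬ IsEmpty T → ¬ IsEmpty S → T ⊆T S → C S)

data Term (n : ℕ) : Set where
  sym : Fin n → Term n
  top : Term n
  bot : Term n

evalTerm : {n : ℕ} → Valuation n → Term n → Bool
evalTerm v (sym i) = lookup v i
evalTerm v top = true
evalTerm v bot = false

evalSeq : {n k : ℕ} → Valuation n → Vec (Term n) k → Vec Bool k
evalSeq v a = map (evalTerm v) a

consts : {n k : ℕ} → Vec Bool k → Vec (Term n) k
consts = map (λ { true → top ; false → bot })

syms : {n k : ℕ} → Vec (Fin n) k → Vec (Term n) k
syms = map sym

data Formula (n : ℕ) : Set where
  ⊤F ⊥F • : Formula n
  incl     : {k : ℕ} → Vec (Term n) k → Vec (Term n) k → Formula n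
  inclNE   : {k : ℕ} → Vec (Term n) k → Vec (Term n) k → Formula n
  inclFull : {k : ℕ} → Vec (Term n) k → Vec (Term n) k → Formula n
  _∧F_ _∨F_ _⊔F_ : Formula n → Formula n → Formula n

InclSat : {n k : ℕ} → Team n → Vec (Term n) k → Vec (Term n) k → Set
InclSat T a b = ∀ v → v ∈T T → ∃ λ v' → v' ∈T T × evalSeq v a ≡ evalSeq v' b

_⊨_ : {n : ℕ} → Team n → Formula n → Set
T ⊨ ⊤F = ⊤
T ⊨ ⊥F = IsEmpty T
T ⊨ • = IsFull T
T ⊨ incl a b = InclSat T a b
T ⊨ inclNE a b = (¬ IsEmpty T) × InclSat T a b
T ⊨ inclFull a b = IsFull T ⊎ InclSat T a b
T ⊨ (φ ∧F ψ) = (T ⊨ φ) × (T ⊨ ψ)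
T ⊨ (φ ∨F ψ) = Σ (Team _) λ T₁ → Σ (Team _) λ T₂ →
  (T₁ ⊆T T) × (T₂ ⊆T T) × (∀ v → v ∈T T → (v ∈T T₁) ⊎ (v ∈T T₂)) ×
  (T₁ ⊨ φ) × (T₂ ⊨ ψ)
T ⊨ (φ ⊔F ψ) = (T ⊨ φ) ⊎ (T ⊨ ψ)

⟦_⟧ : {n : ℕ} → Formula n → Team n → Set
⟦ φ ⟧ T = T ⊨ φ

NoRepeat : {n k : ℕ} → Vec (Fin n) k → Set
NoRepeat p = Injective _≡_ _≡_ (lookup p)

data Lqu (n : ℕ) : Set where
  ⊥ : Lqu n
  atom : {k : ℕ} (x : Vec Bool k) (p : Vec (Fin n) k) → NoRepeat p → Lqu n
  _∧_ _⊔_ : Lqu n → Lqu n → Lqu n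

data Lu (n : ℕ) : Set where
  ⊤' : Lu n
  atom : {k : ℕ} (x : Vec Bool k) (p : Vec (Fin n) k) → NoRepeat p → Lu n
  _∧_ _⊔_ : Lu n → Lu n → Lu n

data Lqd (n : ℕ) : Set where
  • : Lqd n
  atom : {k : ℕ} (p : Vec (Fin n) k) (x : Vec Bool k) → Lqd n
  _∧_ _∨_ _⊔_ : Lqd n → Lqd n → Lqd n

data Ld (n : ℕ) : Set where
  ⊥ : Ld n
  atom : {k : ℕ} (p : Vec (Fin n) k) (x : Vec Bool k) → Ld n
  _∧_ _∨_ _⊔_ : Ld n → Ld n → Ld n

quF : {n : ℕ} → Lqu n → Formula n
quF ⊥ = ⊥F
quF (atom x p _) = incl (consts x) (syms p)
quF (φ ∧ ψ) = quF φ ∧F quF ψ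
quF (φ ⊔ ψ) = quF φ ⊔F quF ψ

uF : {n : ℕ} → Lu n → Formula n
uF ⊤' = ⊤F
uF (atom x p _) = inclNE (consts x) (syms p)
uF (φ ∧ ψ) = uF φ ∧F uF ψ
uF (φ ⊔ ψ) = uF φ ⊔F uF ψ

qdF : {n : ℕ} → Lqd n → Formula n
qdF • = •
qdF (atom p x) = inclFull (syms p) (consts x)
qdF (φ ∧ ψ) = qdF φ ∧F qdF ψ
qdF (φ ∨ ψ) = qdF φ ∨F qdF ψ
qdF (φ ⊔ ψ) = qdF φ ⊔F qdF ψ

dF : {n : ℕ} → Ld n → Formula n
dF ⊥ = ⊥F
dF (atom p x) = incl (syms p) (consts x)
dF (φ ∧ ψ) = dF φ ∧F dF ψ
dF (φ ∨ ψ) = dF φ ∨F dF ψ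
dF (φ ⊔ ψ) = dF φ ⊔F dF ψ

-- An atom p ⊆ x with constant x says that every valuation of the team maps p
-- to x, which survives passing to subteams; an atom x ⊆ p says that some
-- valuation of the team maps p to x, which survives enlarging a nonempty team.
-- Conjunction and global disjunction preserve any closure property, and lax
-- disjunction preserves downward closure: a subteam S of T₁ ∪ T₂ splits as
-- (S ∩ T₁) ∪ (S ∩ T₂).  The quasi variants are closure properties on the
-- nonempty (resp. non-full) teams, a side condition which is itself upward
-- (resp. downward) closed; every formula holds at ∅ (resp. 𝔽) directly.
module Submission where

open import Defs
open import Data.Nat using (ℕ; zero; suc)
open import Data.Bool using (Bool; true; false; _≟_) renaming (_∧_ to _&&_)
open import Data.Vec using (Vec; []; _∷_)
open import Data.Product using (_×_; _,_; ∃)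
open import Data.Sum using (_⊎_; inj₁; inj₂; [_,_]′; map)
open import Data.Empty using (⊥-elim)
open import Data.Unit using (tt)
open import Function using (flip)
open import Relation.Nullary using (Dec; ¬_)
open import Relation.Nullary.Decidable using (map′; _⊎-dec_; decidable-stable)
open import Relation.Unary using (Decidable; U; ∁)
open import Relation.Binary.PropositionalEquality using (_≡_; refl; cong)
open Relation.Binary.PropositionalEquality.≡-Reasoning

evalSeq-consts : {n k : ℕ} (v : Valuation n) (x : Vec Bool k) →
                 evalSeq v (consts x) ≡ x
evalSeq-consts v []          = refl
evalSeq-consts v (true ∷ x)  = cong (true ∷_) (evalSeq-consts v x)
evalSeq-consts v (false ∷ x) = cong (false ∷_) (evalSeq-consts v x)

∃-valuation? : {n : ℕ} {P : Valuation n → Set} → Decidable P → Dec (∃ P)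
∃-valuation? {zero} P? = map′ ([] ,_) (λ { ([] , p) → p }) (P? [])
∃-valuation? {suc n} {P} P? =
  map′ [ extend true , extend false ]′ split
       (∃-valuation? (λ v → P? (true ∷ v)) ⊎-dec ∃-valuation? (λ v → P? (false ∷ v)))
  where
  extend : ∀ b → ∃ (λ v → P (b ∷ v)) → ∃ P
  extend b (v , p) = b ∷ v , p
  split : ∃ P → ∃ (λ v → P (true ∷ v)) ⊎ ∃ (λ v → P (false ∷ v))
  split (true ∷ v , p) = inj₁ (v , p)
  split (false ∷ v , p) = inj₂ (v , p)

module _ {n : ℕ} where

  -- Constructively, a nonempty team yields a member by searching all 2ⁿ valuations.
  nonEmpty⇒inhabited : {T : Team n} → ¬ IsEmpty T → ∃ (_∈T T)
  nonEmpty⇒inhabited {T} ¬empty =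
    decidable-stable (∃-valuation? (λ v → T v ≟ true)) (λ ∄ → ¬empty (λ v v∈T → ∄ (v , v∈T)))

  nonEmpty-upwardClosed : UpwardClosed {n} (∁ IsEmpty)
  nonEmpty-upwardClosed T S ¬empty T⊆S empty = ¬empty (λ v v∈T → empty v (T⊆S v v∈T))

  nonFull-downwardClosed : DownwardClosed {n} (∁ IsFull)
  nonFull-downwardClosed T S ¬full S⊆T full = ¬full (λ v → S⊆T v (full v))

  _∩T_ : Team n → Team n → Team n
  (S ∩T T) v = S v && T v

  ∩T-⊆ˡ : {S T : Team n} → (S ∩T T) ⊆T S
  ∩T-⊆ˡ {S} v _ with S v
  ... | true = refl

  ∩T-⊆ʳ : {S T : Team n} → (S ∩T T) ⊆T T
  ∩T-⊆ʳ {S} v v∈S∩T with S v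
  ... | true = v∈S∩T

  ∈-∩T : {S T : Team n} {v : Valuation n} → v ∈T S → v ∈T T → v ∈T (S ∩T T)
  ∈-∩T {S} {v = v} v∈S v∈T with S v
  ... | true = v∈T

  ClosedOn : (Team n → Set) → (Team n → Team n → Set) → TeamProp → Set
  ClosedOn G R C = ∀ {T S} → G T → R T S → C T → C S

  module _ {G : Team n → Set} {R : Team n → Team n → Set} {φ ψ : Formula n} where

    ∧F-closedOn : ClosedOn G R ⟦ φ ⟧ → ClosedOn G R ⟦ ψ ⟧ → ClosedOn G R ⟦ φ ∧F ψ ⟧
    ∧F-closedOn φ-closed ψ-closed g r (φT , ψT) = φ-closed g r φT , ψ-closed g r ψT

    ⊔F-closedOn : ClosedOn G R ⟦ φ ⟧ → ClosedOn G R ⟦ ψ ⟧ → ClosedOn G R ⟦ φ ⊔F ψ ⟧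
    ⊔F-closedOn φ-closed ψ-closed g r (inj₁ φT) = inj₁ (φ-closed g r φT)
    ⊔F-closedOn φ-closed ψ-closed g r (inj₂ ψT) = inj₂ (ψ-closed g r ψT)

  ∨F-closedOn : {G : Team n → Set} {φ ψ : Formula n} → DownwardClosed G →
                ClosedOn G (flip _⊆T_) ⟦ φ ⟧ → ClosedOn G (flip _⊆T_) ⟦ ψ ⟧ →
                ClosedOn G (flip _⊆T_) ⟦ φ ∨F ψ ⟧
  ∨F-closedOn G-closed φ-closed ψ-closed {T} {S} gT S⊆T (T₁ , T₂ , T₁⊆T , T₂⊆T , cover , φT₁ , ψT₂) =
    S ∩T T₁ , S ∩T T₂ , ∩T-⊆ˡ , ∩T-⊆ˡ , cover′ ,
    φ-closed (G-closed T T₁ gT T₁⊆T) ∩T-⊆ʳ φT₁ ,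
    ψ-closed (G-closed T T₂ gT T₂⊆T) ∩T-⊆ʳ ψT₂
    where
    cover′ : ∀ v → v ∈T S → (v ∈T (S ∩T T₁)) ⊎ (v ∈T (S ∩T T₂))
    cover′ v v∈S = map (∈-∩T {S} {T₁} v∈S) (∈-∩T {S} {T₂} v∈S) (cover v (S⊆T v v∈S))

  ∨F-both : {T : Team n} {φ ψ : Formula n} → T ⊨ φ → T ⊨ ψ → T ⊨ (φ ∨F ψ)
  ∨F-both {T} φT ψT = T , T , (λ _ v∈T → v∈T) , (λ _ v∈T → v∈T) , (λ _ → inj₁) , φT , ψT

  module _ {k : ℕ} (x : Vec Bool k) {T S : Team n} where

    incl-consts-downward : {a : Vec (Term n) k} →
                           InclSat T a (consts x) → S ⊆T T → InclSat S a (consts x)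
    incl-consts-downward {a} a⊆x S⊆T v v∈S with a⊆x v (S⊆T v v∈S)
    ... | v′ , _ , v[a]≡v′[x] = v , v∈S , (begin
      evalSeq v a             ≡⟨ v[a]≡v′[x] ⟩
      evalSeq v′ (consts x)   ≡⟨ evalSeq-consts v′ x ⟩
      x                       ≡⟨ evalSeq-consts v x ⟨
      evalSeq v (consts x)    ∎)

    incl-consts-upward : {b : Vec (Term n) k} → ¬ IsEmpty T →
                         InclSat T (consts x) b → T ⊆T S → InclSat S (consts x) b
    incl-consts-upward {b} ¬empty x⊆b T⊆S v _ with nonEmpty⇒inhabited ¬empty
    ... | w , w∈T with x⊆b w w∈T
    ... | v′ , v′∈T , w[x]≡v′[b] = v′ , T⊆S v′ v′∈T , (begin
      evalSeq v (consts x)    ≡⟨ evalSeq-consts v x ⟩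
      x                       ≡⟨ evalSeq-consts w x ⟨
      evalSeq w (consts x)    ≡⟨ w[x]≡v′[b] ⟩
      evalSeq v′ b            ∎)

  quF-empty : (φ : Lqu n) → emptyTeam ⊨ quF φ
  quF-empty ⊥            = λ _ ()
  quF-empty (atom x p _) = λ _ ()
  quF-empty (φ ∧ ψ)      = quF-empty φ , quF-empty ψ
  quF-empty (φ ⊔ ψ)      = inj₁ (quF-empty φ)

  quF-upward : (φ : Lqu n) → ClosedOn (∁ IsEmpty) _⊆T_ ⟦ quF φ ⟧
  quF-upward ⊥            ¬empty _ empty = ⊥-elim (¬empty empty)
  quF-upward (atom x p _) ¬empty T⊆S x⊆p = incl-consts-upward x ¬empty x⊆p T⊆S
  quF-upward (φ ∧ ψ)      = ∧F-closedOn (quF-upward φ) (quF-upward ψ)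
  quF-upward (φ ⊔ ψ)      = ⊔F-closedOn (quF-upward φ) (quF-upward ψ)

  uF-upward : (φ : Lu n) → ClosedOn U _⊆T_ ⟦ uF φ ⟧
  uF-upward ⊤'           _ _ _ = tt
  uF-upward (atom x p _) _ T⊆S (¬empty , x⊆p) =
    nonEmpty-upwardClosed _ _ ¬empty T⊆S , incl-consts-upward x ¬empty x⊆p T⊆S
  uF-upward (φ ∧ ψ)      = ∧F-closedOn (uF-upward φ) (uF-upward ψ)
  uF-upward (φ ⊔ ψ)      = ⊔F-closedOn (uF-upward φ) (uF-upward ψ)

  qdF-full : (φ : Lqd n) → fullTeam ⊨ qdF φ
  qdF-full •          = λ _ → refl
  qdF-full (atom p x) = inj₁ (λ _ → refl)
  qdF-full (φ ∧ ψ)    = qdF-full φ , qdF-full ψ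
  qdF-full (φ ∨ ψ)    = ∨F-both (qdF-full φ) (qdF-full ψ)
  qdF-full (φ ⊔ ψ)    = inj₁ (qdF-full φ)

  qdF-downward : (φ : Lqd n) → ClosedOn (∁ IsFull) (flip _⊆T_) ⟦ qdF φ ⟧
  qdF-downward •          ¬full _ full        = ⊥-elim (¬full full)
  qdF-downward (atom p x) ¬full _ (inj₁ full) = ⊥-elim (¬full full)
  qdF-downward (atom p x) _ S⊆T (inj₂ p⊆x)    = inj₂ (incl-consts-downward x p⊆x S⊆T)
  qdF-downward (φ ∧ ψ)    = ∧F-closedOn (qdF-downward φ) (qdF-downward ψ)
  qdF-downward (φ ∨ ψ)    = ∨F-closedOn nonFull-downwardClosed (qdF-downward φ) (qdF-downward ψ)
  qdF-downward (φ ⊔ ψ)    = ⊔F-closedOn (qdF-downward φ) (qdF-downward ψ)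

  dF-downward : (φ : Ld n) → ClosedOn U (flip _⊆T_) ⟦ dF φ ⟧
  dF-downward ⊥          _ S⊆T empty = λ v v∈S → empty v (S⊆T v v∈S)
  dF-downward (atom p x) _ S⊆T p⊆x   = incl-consts-downward x p⊆x S⊆T
  dF-downward (φ ∧ ψ)    = ∧F-closedOn (dF-downward φ) (dF-downward ψ)
  dF-downward (φ ∨ ψ)    = ∨F-closedOn (λ _ _ _ _ → tt) (dF-downward φ) (dF-downward ψ)
  dF-downward (φ ⊔ ψ)    = ⊔F-closedOn (dF-downward φ) (dF-downward ψ)

mainTheorem1 : (n : ℕ) →
    ((φ : Lqu n) → QuasiUpwardClosed ⟦ quF φ ⟧) ×
    ((φ : Lu n) → UpwardClosed ⟦ uF φ ⟧) ×
    ((φ : Lqd n) → QuasiDownwardClosed ⟦ qdF φ ⟧) ×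
    ((φ : Ld n) → DownwardClosed ⟦ dF φ ⟧)
mainTheorem1 n =
  -- The hypothesis that S is nonempty (resp. not full) is redundant: it follows from T ⊆ S (resp. S ⊆ T).
  (λ φ → quF-empty φ , λ T S φT ¬empty _ T⊆S → quF-upward φ ¬empty T⊆S φT) ,
  (λ φ T S φT T⊆S → uF-upward φ tt T⊆S φT) ,
  (λ φ → qdF-full φ , λ T S φT ¬full _ S⊆T → qdF-downward φ ¬full S⊆T φT) ,
  (λ φ T S φT S⊆T → dF-downward φ tt S⊆T φT)
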